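{- For each integer $n\geq 1$, $\mathsf{RT}^n \leq_{\mathrm{sW}} \mathbb{Z}\text{ - }\mathsf{RT}^{n+1}$; that is, Ramsey's theorem for $n$-subsets is strongly Weihrauch reducible to the $\mathbb{Z}$-Ramsey's theorem for $(n+1)$-subsets.
   Context: For a positive integer $k$ we identify $k$ with $\{0,\dots,k-1\}$, and $[\mathbb N]^n$ denotes the set of $n$-element subsets of $\mathbb N$. $\mathsf{RT}^n$ is the problem whose instances are colourings $c:[\mathbb N]^n\to k$ (any finite $k$) and whose solutions are infinite sets $X\subseteq\mathbb N$ with $[X]^n$ monochromatic for $c$. A colouring $c:[\mathbb N]^n\to k$ is $\mathbb Z$-invariant if $c(\{x_1,\dots,x_n\})=c(\{x_1+z,\dots,x_n+z\})$ for all $\{x_1,\dots,x_n\}\in[\mathbb N]^n$ and all $z\in\mathbb N$. $\mathbb{Z}\text{ - }\mathsf{RT}^n$ is the problem whose instances are $\mathbb Z$-invariant colourings $c:[\mathbb N]^n\to k$ and whose solutions are infinite sets $X\subseteq \mathbb N$ with $[X]^n$ $c$-monochromatic. A problem $P$ is strongly Weihrauch reducible to a problem $Q$ ($P\leq_{\mathrm{sW}}Q$) if there are Turing functionals $\Phi,\Psi$ such that for every instance $X$ of $P$, $\Phi^X$ is an instance of $Q$, and for every solution $Y$ to $\Phi^X$, $\Psi^{Y}$ is a solution to $X$. -}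

module Defs where

open import Data.Nat using (ℕ; zero; suc; _+_; _*_; _≤_; _<_)
open import Data.Fin using (Fin)
open import Data.Unit using (⊤)
open import Data.Vec using (Vec; []; _∷_; lookup; map)
open import Data.Product using (Σ; ∃; _×_; _,_)
open import Relation.Binary.PropositionalEquality using (_≡_)

-- Turing functionals: partial recursive functions relative to an
-- oracle α : ℕ → ℕ (Kleene's μ-recursive schemata with an oracle).

data PR : ℕ → Set where
  Z    : ∀ {n} → PR n
  S    : PR 1
  P    : ∀ {n} → Fin n → PR n
  O    : PR 1
  C    : ∀ {m n} → PR m → Vec (PR n) m → PR n
  R    : ∀ {n} → PR n → PR (suc (suc n)) → PR (suc n)
  M    : ∀ {n} → PR (suc n) → PR n

mutual
  data Eval (α : ℕ → ℕ) : ∀ {n} → PR n → Vec ℕ n → ℕ → Set where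
    evZ : ∀ {n} {xs : Vec ℕ n} → Eval α Z xs 0
    evS : ∀ {x} → Eval α S (x ∷ []) (suc x)
    evP : ∀ {n} {i : Fin n} {xs : Vec ℕ n} → Eval α (P i) xs (lookup xs i)
    evO : ∀ {x} → Eval α O (x ∷ []) (α x)
    evC : ∀ {m n} {f : PR m} {gs : Vec (PR n) m} {xs : Vec ℕ n} {ys : Vec ℕ m} {v} →
          EvalAll α gs xs ys → Eval α f ys v → Eval α (C f gs) xs v
    evR0 : ∀ {n} {f : PR n} {g : PR (suc (suc n))} {xs : Vec ℕ n} {v} →
           Eval α f xs v → Eval α (R f g) (0 ∷ xs) v
    evRS : ∀ {n} {f : PR n} {g : PR (suc (suc n))} {xs : Vec ℕ n} {y r v} →
           Eval α (R f g) (y ∷ xs) r → Eval α g (y ∷ r ∷ xs) v →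
           Eval α (R f g) (suc y ∷ xs) v
    evM : ∀ {n} {f : PR (suc n)} {xs : Vec ℕ n} {y} →
          Eval α f (y ∷ xs) 0 →
          (∀ z → z < y → Σ ℕ λ w → Eval α f (z ∷ xs) (suc w)) →
          Eval α (M f) xs y

  data EvalAll (α : ℕ → ℕ) {n : ℕ} : ∀ {m} → Vec (PR n) m → Vec ℕ n → Vec ℕ m → Set where
    []  : ∀ {xs} → EvalAll α [] xs []
    _∷_ : ∀ {m} {g : PR n} {gs : Vec (PR n) m} {xs : Vec ℕ n} {y ys} →
          Eval α g xs y → EvalAll α gs xs ys → EvalAll α (g ∷ gs) xs (y ∷ ys)

Computes : PR 1 → (ℕ → ℕ) → (ℕ → ℕ) → Set
Computes Φ α β = ∀ i → Eval α Φ (i ∷ []) (β i)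

record Problem : Set₁ where
  field
    Inst : (ℕ → ℕ) → Set
    Sol  : (ℕ → ℕ) → (ℕ → ℕ) → Set   -- Sol X Y : Y is a solution to instance X

open Problem public

_≤sW_ : Problem → Problem → Set
A ≤sW B = Σ (PR 1) λ Φ → Σ (PR 1) λ Ψ →
  ∀ X → Inst A X →
    Σ (ℕ → ℕ) λ QX → Computes Φ X QX × Inst B QX ×
      (∀ Y → Sol B QX Y →
        Σ (ℕ → ℕ) λ PY → Computes Ψ Y PY × Sol A X PY)

-- Coding of n-subsets of ℕ (as strictly increasing n-tuples) by numbers.

tri : ℕ → ℕ
tri zero    = 0
tri (suc s) = tri s + suc s

pair : ℕ → ℕ → ℕ
pair a b = tri (a + b) + b

code : ∀ {n} → Vec ℕ n → ℕ
code []       = 0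
code (x ∷ xs) = pair x (code xs)

Increasing : ∀ {n} → Vec ℕ n → Set
Increasing []           = ⊤
Increasing (x ∷ [])     = ⊤
Increasing (x ∷ y ∷ xs) = x < y × Increasing (y ∷ xs)

-- A colouring c : [ℕ]^n → k is represented by an oracle X with
--   X 0 = k  and  X (suc (code xs)) = c({x₁,…,xₙ}) for increasing xs.
colour : (ℕ → ℕ) → ∀ {n} → Vec ℕ n → ℕ
colour X xs = X (suc (code xs))

IsColouring : ℕ → (ℕ → ℕ) → Set
IsColouring n X = 1 ≤ X 0 × (∀ (xs : Vec ℕ n) → Increasing xs → colour X xs < X 0)

ZInvariant : ℕ → (ℕ → ℕ) → Set
ZInvariant n X = ∀ (xs : Vec ℕ n) (z : ℕ) → Increasing xs →
  colour X xs ≡ colour X (map (_+ z) xs)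

-- A subset of ℕ is represented by its characteristic function (values in {0,1}).
IsSet : (ℕ → ℕ) → Set
IsSet Y = ∀ i → Y i ≤ 1

_∈ₛ_ : ℕ → (ℕ → ℕ) → Set
i ∈ₛ Y = Y i ≡ 1

AllIn : ∀ {n} → Vec ℕ n → (ℕ → ℕ) → Set
AllIn []       Y = ⊤
AllIn (x ∷ xs) Y = x ∈ₛ Y × AllIn xs Y

Infinite : (ℕ → ℕ) → Set
Infinite Y = ∀ m → Σ ℕ λ x → m ≤ x × x ∈ₛ Y

Homogeneous : ℕ → (ℕ → ℕ) → (ℕ → ℕ) → Set
Homogeneous n X Y = ∀ (xs ys : Vec ℕ n) → Increasing xs → Increasing ys →
  AllIn xs Y → AllIn ys Y → colour X xs ≡ colour X ys

RTSol : ℕ → (ℕ → ℕ) → (ℕ → ℕ) → Set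
RTSol n X Y = IsSet Y × Infinite Y × Homogeneous n X Y

RT : ℕ → Problem
RT n = record { Inst = IsColouring n ; Sol = RTSol n }

Z-RT : ℕ → Problem
Z-RT n = record { Inst = λ X → IsColouring n X × ZInvariant n X ; Sol = RTSol n }

{-# OPTIONS --safe #-}
module Submission where

open import Data.Nat using (ℕ; suc; _≤_)
open import Defs

open import Data.Nat using (zero; _+_; _∸_; _<_; pred; z≤n; s≤s; _≟_; _<?_)
open import Data.Nat.Properties
open import Data.Nat.Induction using (<-rec)
open import Data.Fin.Patterns using (0F; 1F)
open import Data.Vec using (Vec; []; _∷_; map)
open import Data.Vec.Properties using (map-∘; map-cong; map-id)
open import Data.Product using (Σ; ∃; _×_; _,_; proj₁; proj₂)
open import Data.Unit using (tt)
open import Data.Empty using (⊥-elim)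
open import Function.Base using (_∘_; id)
open import Function.Bundles using (_⇔_; mk⇔; Equivalence)
open import Relation.Nullary using (¬_; yes; no)
open import Relation.Unary using (Decidable)
open import Relation.Binary.PropositionalEquality

-- The colouring d {x₀ < x₁ < … < xₙ} = c {x₁ ∸ (x₀ + 1), …, xₙ ∸ (x₀ + 1)} is computable from
-- c and depends only on the differences of its arguments, so it is ℤ-invariant.  If Y is
-- d-homogeneous and m ∈ Y, then {x ∸ (m + 1) : m < x ∈ Y} is c-homogeneous, because
-- d {m, m + 1 + x₁, …, m + 1 + xₙ} = c {x₁, …, xₙ}; choosing m = min Y, found by unbounded
-- search, makes this set computable from Y alone.

Least : (ℕ → Set) → ℕ → Set
Least Q y = Q y × (∀ {z} → z < y → ¬ Q z)

least : ∀ {Q : ℕ → Set} → Decidable Q → ∀ {x} → Q x → ∃ (Least Q)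
least {Q} Q? {x} = <-rec (λ x → Q x → ∃ (Least Q)) search x
  where
  search : ∀ x → (∀ {y} → y < x → Q y → ∃ (Least Q)) → Q x → ∃ (Least Q)
  search x smaller qx with anyUpTo? Q? x
  ... | yes (y , y<x , qy) = smaller y<x qy
  ... | no none            = x , qx , λ z<x qz → none (_ , z<x , qz)

Least-unique : ∀ {Q x y} → Least Q x → Least Q y → x ≡ y
Least-unique (qx , x-least) (qy , y-least) =
  ≤-antisym (≮⇒≥ λ y<x → x-least y<x qy) (≮⇒≥ λ x<y → y-least x<y qx)

Realises₁ : PR 1 → (ℕ → ℕ) → Set
Realises₁ e f = ∀ {α} x → Eval α e (x ∷ []) (f x)

Realises₂ : PR 2 → (ℕ → ℕ → ℕ) → Set
Realises₂ e f = ∀ {α} x y → Eval α e (x ∷ y ∷ []) (f x y)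

module _ {α : ℕ → ℕ} {m : ℕ} {xs : Vec ℕ m} where

  eval-∘₁ : ∀ {f g a} {F : ℕ → ℕ} → Realises₁ f F → Eval α g xs a →
            Eval α (C f (g ∷ [])) xs (F a)
  eval-∘₁ {a = a} f-ok g-ev = evC (g-ev ∷ []) (f-ok a)

  eval-∘₂ : ∀ {f g h a b} {F : ℕ → ℕ → ℕ} → Realises₂ f F → Eval α g xs a →
            Eval α h xs b → Eval α (C f (g ∷ h ∷ [])) xs (F a b)
  eval-∘₂ {a = a} {b} f-ok g-ev h-ev = evC (g-ev ∷ h-ev ∷ []) (f-ok a b)

  eval-M : ∀ {f : PR (suc m)} {g : ℕ → ℕ} {Q : ℕ → Set} {y} →
           (∀ z → Eval α f (z ∷ xs) (g z)) → (∀ {z} → g z ≡ 0 ⇔ Q z) →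
           Least Q y → Eval α (M f) xs y
  eval-M {f} {g} {y = y} f-ok g≡0⇔Q (qy , y-least) =
    evM (subst (Eval α f (y ∷ xs)) (Equivalence.from g≡0⇔Q qy) (f-ok y)) positive
    where
    positive : ∀ z → z < y → Σ ℕ λ w → Eval α f (z ∷ xs) (suc w)
    positive z z<y with g z | f-ok z | Equivalence.to (g≡0⇔Q {z})
    ... | zero  | _  | Q[z] = ⊥-elim (y-least z<y (Q[z] refl))
    ... | suc w | ev | _    = w , ev

S-correct : Realises₁ S suc
S-correct x = evS

addᴾ : PR 2
addᴾ = R (P 0F) (C S (P 1F ∷ []))

addᴾ-correct : Realises₂ addᴾ _+_
addᴾ-correct zero    y = evR0 evP
addᴾ-correct (suc x) y = evRS (addᴾ-correct x y) (eval-∘₁ S-correct evP)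

predᴾ : PR 1
predᴾ = R Z (P 0F)

predᴾ-correct : Realises₁ predᴾ pred
predᴾ-correct zero    = evR0 evZ
predᴾ-correct (suc x) = evRS (predᴾ-correct x) evP

subtractFromᴾ : PR 2
subtractFromᴾ = R (P 0F) (C predᴾ (P 1F ∷ []))

subtractFromᴾ-correct : Realises₂ subtractFromᴾ (λ x y → y ∸ x)
subtractFromᴾ-correct zero    y = evR0 evP
subtractFromᴾ-correct (suc x) y = evRS (subtractFromᴾ-correct x y)
  (subst (Eval _ _ _) (pred[m∸n]≡m∸[1+n] y x) (eval-∘₁ predᴾ-correct evP))

monusᴾ : PR 2
monusᴾ = C subtractFromᴾ (P 1F ∷ P 0F ∷ [])

monusᴾ-correct : Realises₂ monusᴾ _∸_
monusᴾ-correct x y = eval-∘₂ subtractFromᴾ-correct evP evP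

triᴾ : PR 1
triᴾ = R Z (C addᴾ (P 1F ∷ C S (P 0F ∷ []) ∷ []))

triᴾ-correct : Realises₁ triᴾ tri
triᴾ-correct zero    = evR0 evZ
triᴾ-correct (suc s) = evRS (triᴾ-correct s) (eval-∘₂ addᴾ-correct evP (eval-∘₁ S-correct evP))

pairᴾ : PR 2
pairᴾ = C addᴾ (C triᴾ (addᴾ ∷ []) ∷ P 1F ∷ [])

pairᴾ-correct : Realises₂ pairᴾ pair
pairᴾ-correct a b = eval-∘₂ addᴾ-correct (eval-∘₁ triᴾ-correct (addᴾ-correct a b)) evP

tri-mono-≤ : ∀ {m n} → m ≤ n → tri m ≤ tri n
tri-mono-≤ z≤n       = z≤n
tri-mono-≤ (s≤s m≤n) = +-mono-≤ (tri-mono-≤ m≤n) (s≤s m≤n)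

diag-least : ∀ j → ∃ (Least λ s → j < tri (suc s))
diag-least j = least (λ s → j <? tri (suc s)) (m≤n+m (suc j) (tri j))

diag : ℕ → ℕ
diag j = proj₁ (diag-least j)

snd : ℕ → ℕ
snd j = j ∸ tri (diag j)

fst : ℕ → ℕ
fst j = diag j ∸ snd j

pair-diag-least : ∀ a b → Least (λ s → pair a b < tri (suc s)) (a + b)
pair-diag-least a b = +-monoʳ-< (tri (a + b)) (s≤s (m≤n+m b a)) , below
  where
  below : ∀ {z} → z < a + b → ¬ pair a b < tri (suc z)
  below z<a+b j<tri = <⇒≱ j<tri (≤-trans (tri-mono-≤ z<a+b) (m≤m+n (tri (a + b)) b))

diag-pair : ∀ a b → diag (pair a b) ≡ a + b
diag-pair a b = Least-unique (proj₂ (diag-least (pair a b))) (pair-diag-least a b)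

snd-pair : ∀ a b → snd (pair a b) ≡ b
snd-pair a b = trans (cong (λ s → pair a b ∸ tri s) (diag-pair a b)) (m+n∸m≡n (tri (a + b)) b)

fst-pair : ∀ a b → fst (pair a b) ≡ a
fst-pair a b = trans (cong₂ _∸_ (diag-pair a b) (snd-pair a b)) (m+n∸n≡m a b)

diagᴾ : PR 1
diagᴾ = M (C monusᴾ (C S (P 1F ∷ []) ∷ C triᴾ (C S (P 0F ∷ []) ∷ []) ∷ []))

diagᴾ-correct : Realises₁ diagᴾ diag
diagᴾ-correct j = eval-M
  (λ s → eval-∘₂ monusᴾ-correct (eval-∘₁ S-correct evP) (eval-∘₁ triᴾ-correct (eval-∘₁ S-correct evP)))
  (mk⇔ m∸n≡0⇒m≤n m≤n⇒m∸n≡0) (proj₂ (diag-least j))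

sndᴾ : PR 1
sndᴾ = C monusᴾ (P 0F ∷ C triᴾ (diagᴾ ∷ []) ∷ [])

sndᴾ-correct : Realises₁ sndᴾ snd
sndᴾ-correct j = eval-∘₂ monusᴾ-correct evP (eval-∘₁ triᴾ-correct (diagᴾ-correct j))

fstᴾ : PR 1
fstᴾ = C monusᴾ (diagᴾ ∷ sndᴾ ∷ [])

fstᴾ-correct : Realises₁ fstᴾ fst
fstᴾ-correct j = eval-∘₂ monusᴾ-correct (diagᴾ-correct j) (sndᴾ-correct j)

mapCoded : (ℕ → ℕ → ℕ) → ℕ → ℕ → ℕ → ℕ
mapCoded f zero    p r = 0
mapCoded f (suc n) p r = pair (f p (fst r)) (mapCoded f n p (snd r))

mapCoded-code : ∀ f {n} p (xs : Vec ℕ n) → mapCoded f n p (code xs) ≡ code (map (f p) xs)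
mapCoded-code f p []       = refl
mapCoded-code f {suc n} p (x ∷ xs) = begin
  pair (f p (fst (pair x (code xs)))) (mapCoded f n p (snd (pair x (code xs))))
    ≡⟨ cong₂ (λ u r → pair (f p u) (mapCoded f n p r)) (fst-pair x (code xs)) (snd-pair x (code xs)) ⟩
  pair (f p x) (mapCoded f n p (code xs))
    ≡⟨ cong (pair (f p x)) (mapCoded-code f p xs) ⟩
  pair (f p x) (code (map (f p) xs)) ∎
  where open ≡-Reasoning

mapCodedᴾ : PR 2 → ℕ → PR 2
mapCodedᴾ F zero    = Z
mapCodedᴾ F (suc n) = C pairᴾ (C F (P 0F ∷ C fstᴾ (P 1F ∷ []) ∷ [])
                             ∷ C (mapCodedᴾ F n) (P 0F ∷ C sndᴾ (P 1F ∷ []) ∷ []) ∷ [])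

mapCodedᴾ-correct : ∀ {F f} → Realises₂ F f → ∀ n → Realises₂ (mapCodedᴾ F n) (mapCoded f n)
mapCodedᴾ-correct F-ok zero    p r = evZ
mapCodedᴾ-correct F-ok (suc n) p r = eval-∘₂ pairᴾ-correct
  (eval-∘₂ F-ok evP (eval-∘₁ fstᴾ-correct evP))
  (eval-∘₂ (mapCodedᴾ-correct F-ok n) evP (eval-∘₁ sndᴾ-correct evP))

gap : ℕ → ℕ → ℕ
gap x₀ x = x ∸ suc x₀

gapᴾ : PR 2
gapᴾ = C monusᴾ (P 1F ∷ C S (P 0F ∷ []) ∷ [])

gapᴾ-correct : Realises₂ gapᴾ gap
gapᴾ-correct x₀ x = eval-∘₂ monusᴾ-correct evP (eval-∘₁ S-correct evP)

gap-increasing : ∀ {n} x₀ (xs : Vec ℕ n) → Increasing (x₀ ∷ xs) → Increasing (map (gap x₀) xs)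
gap-increasing x₀ []           _                   = tt
gap-increasing x₀ (x ∷ [])     _                   = tt
gap-increasing x₀ (x ∷ y ∷ xs) (x₀<x , x<y , y∷xs↑) =
  ∸-monoˡ-< x<y x₀<x , gap-increasing x₀ (y ∷ xs) (<-trans x₀<x x<y , y∷xs↑)

gap-+ : ∀ x₀ z x → gap (x₀ + z) (x + z) ≡ gap x₀ x
gap-+ x₀ z x = trans (cong₂ _∸_ (+-comm x z) (+-comm (suc x₀) z)) ([m+n]∸[m+o]≡n∸o z x (suc x₀))

gap-suc-+ : ∀ m x → gap m (suc m + x) ≡ x
gap-suc-+ m x = m+n∸m≡n (suc m) x

gapColouring : ℕ → (ℕ → ℕ) → ℕ → ℕ
gapColouring n X zero    = X 0
gapColouring n X (suc y) = X (suc (mapCoded gap n (fst y) (snd y)))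

colour-gapColouring : ∀ {n} X x₀ (xs : Vec ℕ n) →
                      colour (gapColouring n X) (x₀ ∷ xs) ≡ colour X (map (gap x₀) xs)
colour-gapColouring {n} X x₀ xs = cong (λ r → X (suc r)) (begin
  mapCoded gap n (fst (pair x₀ (code xs))) (snd (pair x₀ (code xs)))
    ≡⟨ cong₂ (mapCoded gap n) (fst-pair x₀ (code xs)) (snd-pair x₀ (code xs)) ⟩
  mapCoded gap n x₀ (code xs)
    ≡⟨ mapCoded-code gap x₀ xs ⟩
  code (map (gap x₀) xs) ∎)
  where open ≡-Reasoning

gapColouring-isColouring : ∀ {n X} → IsColouring n X → IsColouring (suc n) (gapColouring n X)
gapColouring-isColouring {X = X} (1≤k , c<k) = 1≤k , λ { (x₀ ∷ xs) x₀∷xs↑ →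
  subst (_< X 0) (sym (colour-gapColouring X x₀ xs)) (c<k (map (gap x₀) xs) (gap-increasing x₀ xs x₀∷xs↑)) }

gapColouring-ZInvariant : ∀ {n} X → ZInvariant (suc n) (gapColouring n X)
gapColouring-ZInvariant {n} X (x₀ ∷ xs) z _ = begin
  colour (gapColouring n X) (x₀ ∷ xs)                  ≡⟨ colour-gapColouring X x₀ xs ⟩
  colour X (map (gap x₀) xs)                           ≡⟨ cong (colour X) (map-cong (gap-+ x₀ z) xs) ⟨
  colour X (map (gap (x₀ + z) ∘ (_+ z)) xs)            ≡⟨ cong (colour X) (map-∘ (gap (x₀ + z)) (_+ z) xs) ⟩
  colour X (map (gap (x₀ + z)) (map (_+ z) xs))        ≡⟨ colour-gapColouring X (x₀ + z) (map (_+ z) xs) ⟨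
  colour (gapColouring n X) (x₀ + z ∷ map (_+ z) xs)   ∎
  where open ≡-Reasoning

Φᴾ : ℕ → PR 1
Φᴾ n = R (C O (Z ∷ []))
         (C O (C S (C (mapCodedᴾ gapᴾ n) (C fstᴾ (P 0F ∷ []) ∷ C sndᴾ (P 0F ∷ []) ∷ []) ∷ []) ∷ []))

Φᴾ-correct : ∀ n X → Computes (Φᴾ n) X (gapColouring n X)
Φᴾ-correct n X zero    = evR0 (evC (evZ ∷ []) evO)
Φᴾ-correct n X (suc y) = evRS (Φᴾ-correct n X y) (evC (eval-∘₁ S-correct
  (eval-∘₂ (mapCodedᴾ-correct gapᴾ-correct n) (eval-∘₁ fstᴾ-correct evP) (eval-∘₁ sndᴾ-correct evP)) ∷ []) evO)

shift : ℕ → (ℕ → ℕ) → ℕ → ℕ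
shift m Y i = Y (suc m + i)

shift-infinite : ∀ {m Y} → Infinite Y → Infinite (shift m Y)
shift-infinite {m} {Y} Y-inf k with Y-inf (suc m + k)
... | x , m+1+k≤x , x∈Y = x ∸ suc m , k≤x∸[m+1] , subst (_∈ₛ Y) (sym (m+[n∸m]≡n m+1≤x)) x∈Y
  where
  m+1≤x : suc m ≤ x
  m+1≤x = ≤-trans (m≤m+n (suc m) k) m+1+k≤x
  k≤x∸[m+1] : k ≤ x ∸ suc m
  k≤x∸[m+1] = subst (_≤ x ∸ suc m) (m+n∸m≡n (suc m) k) (∸-monoˡ-≤ (suc m) m+1+k≤x)

increasing-map : ∀ {f : ℕ → ℕ} → (∀ {x y} → x < y → f x < f y) →
                 ∀ {n} (xs : Vec ℕ n) → Increasing xs → Increasing (map f xs)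
increasing-map f-mono []           _            = tt
increasing-map f-mono (x ∷ [])     _            = tt
increasing-map f-mono (x ∷ y ∷ xs) (x<y , y∷xs↑) = f-mono x<y , increasing-map f-mono (y ∷ xs) y∷xs↑

increasing-suc-+ : ∀ {n} m (xs : Vec ℕ n) → Increasing xs → Increasing (m ∷ map (suc m +_) xs)
increasing-suc-+ m []       _   = tt
increasing-suc-+ m (x ∷ xs) xs↑ = s≤s (m≤m+n m x) , increasing-map (+-monoʳ-< (suc m)) (x ∷ xs) xs↑

allIn-shift : ∀ {n m Y} (xs : Vec ℕ n) → AllIn xs (shift m Y) → AllIn (map (suc m +_) xs) Y
allIn-shift []       _           = tt
allIn-shift (x ∷ xs) (x∈ , xs⊆) = x∈ , allIn-shift xs xs⊆

colour-gapColouring-suc-+ : ∀ {n} X m (xs : Vec ℕ n) →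
                            colour (gapColouring n X) (m ∷ map (suc m +_) xs) ≡ colour X xs
colour-gapColouring-suc-+ {n} X m xs = begin
  colour (gapColouring n X) (m ∷ map (suc m +_) xs) ≡⟨ colour-gapColouring X m (map (suc m +_) xs) ⟩
  colour X (map (gap m) (map (suc m +_) xs))        ≡⟨ cong (colour X) (map-∘ (gap m) (suc m +_) xs) ⟨
  colour X (map (gap m ∘ (suc m +_)) xs)            ≡⟨ cong (colour X) (map-cong (gap-suc-+ m) xs) ⟩
  colour X (map id xs)                              ≡⟨ cong (colour X) (map-id xs) ⟩
  colour X xs                                       ∎
  where open ≡-Reasoning

shift-homogeneous : ∀ {n X Y m} → m ∈ₛ Y → Homogeneous (suc n) (gapColouring n X) Y →
                    Homogeneous n X (shift m Y)
shift-homogeneous {n} {X} {m = m} m∈Y hom xs ys xs↑ ys↑ xs⊆ ys⊆ = begin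
  colour X xs                                       ≡⟨ colour-gapColouring-suc-+ X m xs ⟨
  colour (gapColouring n X) (m ∷ map (suc m +_) xs) ≡⟨ hom _ _ (increasing-suc-+ m xs xs↑) (increasing-suc-+ m ys ys↑)
                                                              (m∈Y , allIn-shift xs xs⊆) (m∈Y , allIn-shift ys ys⊆) ⟩
  colour (gapColouring n X) (m ∷ map (suc m +_) ys) ≡⟨ colour-gapColouring-suc-+ X m ys ⟩
  colour X ys                                       ∎
  where open ≡-Reasoning

minᴾ : PR 1
minᴾ = M (C monusᴾ (C S (Z ∷ []) ∷ C O (P 0F ∷ []) ∷ []))

minᴾ-correct : ∀ {Y m} → IsSet Y → Least (_∈ₛ Y) m → ∀ i → Eval Y minᴾ (i ∷ []) m
minᴾ-correct Y-set m-least i = eval-M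
  (λ z → eval-∘₂ monusᴾ-correct (eval-∘₁ S-correct evZ) (evC (evP ∷ []) evO))
  (λ {z} → mk⇔ (λ 1∸Yz≡0 → ≤-antisym (Y-set z) (m∸n≡0⇒m≤n 1∸Yz≡0)) (cong (1 ∸_)))
  m-least

Ψᴾ : PR 1
Ψᴾ = C O (C S (C addᴾ (minᴾ ∷ P 0F ∷ []) ∷ []) ∷ [])

Ψᴾ-correct : ∀ {Y m} → IsSet Y → Least (_∈ₛ Y) m → Computes Ψᴾ Y (shift m Y)
Ψᴾ-correct Y-set m-least i =
  evC (eval-∘₁ S-correct (eval-∘₂ addᴾ-correct (minᴾ-correct Y-set m-least i) evP) ∷ []) evO

mainTheorem1 : (n : ℕ) → 1 ≤ n → RT n ≤sW Z-RT (suc n)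
mainTheorem1 n _ = Φᴾ n , Ψᴾ , λ X X-colouring →
  gapColouring n X , Φᴾ-correct n X ,
  (gapColouring-isColouring {n} {X} X-colouring , gapColouring-ZInvariant X) ,
  λ Y (Y-set , Y-inf , Y-hom) →
    let (m , m-least) = least (λ z → Y z ≟ 1) (proj₂ (proj₂ (Y-inf 0))) in
    shift m Y , Ψᴾ-correct Y-set m-least ,
    (λ i → Y-set (suc m + i)) , shift-infinite Y-inf , shift-homogeneous {n} {X} (proj₁ m-least) Y-hom
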